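{- For any graph $G$ and any positive integer $t$, $\chi(S(G,t))=\chi(G)$, where $\chi$ denotes the chromatic number.
   Context: For a graph $G=(V,E)$ and a positive integer $t$, $V^t$ denotes the set of words $u=u_1u_2\cdots u_t$ of length $t$ over the alphabet $V$. The generalized Sierpiński graph $S(G,t)$ has vertex set $V^t$, and $\{u,v\}$ is an edge if and only if there is $i\in\{1,\dots,t\}$ such that: (i) $u_j=v_j$ for all $j<i$; (ii) $u_i\ne v_i$ and $\{u_i,v_i\}\in E$; (iii) $u_j=v_i$ and $v_j=u_i$ for all $j>i$. Graphs are finite, simple and non-empty. -}

module Defs where

open import Level using (Level; 0ℓ; suc; _⊔_)
open import Data.Nat using (ℕ; _≤_)
open import Data.Fin using (Fin; _<_)
open import Data.Vec using (Vec; lookup)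
open import Data.Product using (Σ; ∃; _×_)
open import Relation.Nullary using (¬_)
open import Relation.Binary.PropositionalEquality using (_≡_; _≢_)

record Graph : Set₁ where
  field
    n     : ℕ
    nonempty : 1 ≤ n
    Adj   : Fin n → Fin n → Set
    sym   : ∀ {x y} → Adj x y → Adj y x
    irrefl : ∀ {x} → ¬ Adj x x
open Graph public

ProperColoring : (V : Set) → (V → V → Set) → ℕ → Set
ProperColoring V E k = Σ (V → Fin k) λ c → ∀ x y → E x y → c x ≢ c y

Colorable : (V : Set) → (V → V → Set) → ℕ → Set
Colorable V E k = ProperColoring V E k

IsChromaticNumber : (V : Set) → (V → V → Set) → ℕ → Set
IsChromaticNumber V E k = Colorable V E k × (∀ m → Colorable V E m → k ≤ m)

-- Edge relation of the generalized Sierpinski graph S(G,t) on words Vec (Fin n) t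
-- (positions indexed by Fin t, 0-based).
SEdge : (G : Graph) (t : ℕ) → Vec (Fin (n G)) t → Vec (Fin (n G)) t → Set
SEdge G t u v =
  ∃ λ (i : Fin t) →
      (∀ (j : Fin t) → j < i → lookup u j ≡ lookup v j)
    × (lookup u i ≢ lookup v i)
    × Adj G (lookup u i) (lookup v i)
    × (∀ (j : Fin t) → i < j → (lookup u j ≡ lookup v i) × (lookup v j ≡ lookup u i))

χ[_]≡_ : Graph → ℕ → Set
χ[ G ]≡ k = IsChromaticNumber (Fin (n G)) (Adj G) k

χS[_,_]≡_ : Graph → ℕ → ℕ → Set
χS[ G , t ]≡ k = IsChromaticNumber (Vec (Fin (n G)) t) (SEdge G t) k

module Submission where

-- The proof is by homomorphic equivalence.  Proper colourings pull back
-- along graph homomorphisms, so two graphs with homomorphisms in both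
-- directions have the same chromatic number.  For words of length t ≥ 1:
--   * the last-letter map S(G,t) → G is a homomorphism: an edge of S(G,t)
--     differing first at position i either has i last, or has last letters
--     v_i and u_i, which are adjacent in G by symmetry;
--   * for a fixed letter a, the map x ↦ a⋯a x is a homomorphism G → S(G,t):
--     the images of adjacent x, y agree everywhere except at the last
--     position, where they are adjacent.

open import Defs
open import Data.Nat using (ℕ; suc; _≤_; s≤s; z≤n)
open import Data.Nat.Properties using (<⇒≱)
open import Data.Fin using (Fin; fromℕ; fromℕ<; _<_)
open import Data.Fin.Properties using (≤fromℕ; ≤∧≢⇒<; <-irrefl; _≟_)
open import Data.Vec using (Vec; lookup; tabulate)
open import Data.Vec.Properties using (lookup∘tabulate)
open import Data.Product using (Σ; _,_)
open import Data.Empty using (⊥-elim)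
open import Relation.Nullary using (yes; no)
open import Relation.Binary.PropositionalEquality
  using (_≡_; _≢_; refl; trans; subst₂)
  renaming (sym to ≡-sym)

Homomorphism : (V : Set) → (V → V → Set) → (W : Set) → (W → W → Set) → Set
Homomorphism V E W F = Σ (V → W) λ h → ∀ x y → E x y → F (h x) (h y)

pullback-coloring : ∀ {V W E F k} → Homomorphism V E W F →
                    ProperColoring W F k → ProperColoring V E k
pullback-coloring (h , h-hom) (c , c-ok) =
  (λ x → c (h x)) , λ x y e → c-ok (h x) (h y) (h-hom x y e)

chromatic-hom-equivalence : ∀ {V W E F k} →
                            Homomorphism V E W F → Homomorphism W F V E →
                            IsChromaticNumber W F k → IsChromaticNumber V E k
chromatic-hom-equivalence to from (col , minimal) =
  pullback-coloring to col , λ m colV → minimal m (pullback-coloring from colV)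

adjacent⇒distinct : (G : Graph) → ∀ {x y} → Adj G x y → x ≢ y
adjacent⇒distinct G adj refl = irrefl G adj

module Words (G : Graph) (t : ℕ) where

  Word : Set
  Word = Vec (Fin (n G)) (suc t)

  lastPos : Fin (suc t)
  lastPos = fromℕ t

  before-last : ∀ j → j ≢ lastPos → j < lastPos
  before-last j j≢last = ≤∧≢⇒< (≤fromℕ j) j≢last

  lastLetter-hom : Homomorphism Word (SEdge G (suc t)) (Fin (n G)) (Adj G)
  lastLetter-hom = (λ u → lookup u lastPos) , preserves
    where
    preserves : ∀ u v → SEdge G (suc t) u v →
                Adj G (lookup u lastPos) (lookup v lastPos)
    preserves u v (i , _ , _ , adj , suffix) with i ≟ lastPos
    ... | yes refl = adj
    ... | no i≢last with suffix lastPos (before-last i i≢last)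
    ...   | uLast≡vi , vLast≡ui =
      subst₂ (Adj G) (≡-sym uLast≡vi) (≡-sym vLast≡ui) (Graph.sym G adj)

  module Padded (a : Fin (n G)) where

    letter : Fin (n G) → Fin (suc t) → Fin (n G)
    letter x j with j ≟ lastPos
    ... | yes _ = x
    ... | no _  = a

    padded : Fin (n G) → Word
    padded x = tabulate (letter x)

    padded-last : ∀ x → lookup (padded x) lastPos ≡ x
    padded-last x rewrite lookup∘tabulate (letter x) lastPos with lastPos ≟ lastPos
    ... | yes _ = refl
    ... | no last≢last = ⊥-elim (last≢last refl)

    padded-other : ∀ x j → j ≢ lastPos → lookup (padded x) j ≡ a
    padded-other x j j≢last rewrite lookup∘tabulate (letter x) j with j ≟ lastPos
    ... | yes j≡last = ⊥-elim (j≢last j≡last)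
    ... | no _ = refl

    padded-hom : Homomorphism (Fin (n G)) (Adj G) Word (SEdge G (suc t))
    padded-hom = padded , edge
      where
      edge : ∀ x y → Adj G x y → SEdge G (suc t) (padded x) (padded y)
      edge x y adj =
          lastPos
        , (λ j j<last → let j≢last = λ j≡last → <-irrefl j≡last j<last in
             trans (padded-other x j j≢last) (≡-sym (padded-other y j j≢last)))
        , adjacent⇒distinct G adj'
        , adj'
        , (λ j last<j → ⊥-elim (<⇒≱ last<j (≤fromℕ j)))
        where
        adj' : Adj G (lookup (padded x) lastPos) (lookup (padded y) lastPos)
        adj' = subst₂ (Adj G) (≡-sym (padded-last x)) (≡-sym (padded-last y)) adj

theorem5 : (G : Graph) (t : ℕ) → 1 ≤ t → (k : ℕ) → χ[ G ]≡ k → χS[ G , t ]≡ k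
theorem5 G (suc t) (s≤s z≤n) k χG≡k =
  chromatic-hom-equivalence lastLetter-hom (padded-hom someVertex) χG≡k
  where
  open Words G t
  open Padded using (padded-hom)

  someVertex : Fin (n G)
  someVertex = fromℕ< (nonempty G)
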